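{- Let $\overrightarrow{G}$ be a DDMOG on $n$ vertices with DDM labeling $g$, and index its vertices $v_1,\dots,v_n$ so that $g(v_i)=i$. Let $\overrightarrow{H}$ be an oriented graph on $m$ vertices, vertex-disjoint from $\overrightarrow{G}$, with a bijective labeling $h: V(\overrightarrow{H})\to\{n+1,\dots,n+m\}$ such that $k=\max_{v\in V(\overrightarrow{H})}|wt_h(v)|\le n$ and such that for every $0\le i\le k$, $\sum_{v\in V_h^{i}(\overrightarrow{H})} h(v)=\sum_{v\in V_h^{ -i}(\overrightarrow{H})} h(v)$. Then the weighted sum $\overrightarrow{G}\oplus_{wt_h}^0\overrightarrow{H}$ is a DDMOG on $n+m$ vertices.
   Context: An oriented graph is a digraph with no loops, no multiple arcs, and such that $(u,v)$ being an arc implies $(v,u)$ is not an arc. $N^+(v)$ is the set of $u$ with $(u,v)$ an arc, $N^-(v)$ the set of $u$ with $(v,u)$ an arc. For a labeling $f$, $wt_f(v)=\sum_{u\in N^+(v)} f(u) - \sum_{u \in N^-(v)} f(u)$. A DDM labeling of an oriented graph on $n$ vertices is a bijection $f:V\to\{1,\dots,n\}$ with $wt_f(v)=0$ for all $v$; a DDMOG is an oriented graph admitting one. For an oriented graph $\overrightarrow{H}$ with labeling $h$ and integer $j$, $V_h^{j}(\overrightarrow{H})=\{u\in V(\overrightarrow{H}): wt_h(u)=j\}$. Weighted sum: let $\overrightarrow{G}$ have vertices $v_1,\dots,v_n$ indexed by a labeling $g$ with $g(v_i)=i$, let $s$ be an integer, and let $\overrightarrow{H}$ (vertex-disjoint from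 $\overrightarrow{G}$) have a labeling $h:V(\overrightarrow{H})\to\mathbb{Z}^+$ with $\{|wt_h(u)|:u\in V(\overrightarrow{H})\}\subseteq\{0\}\cup\{i+s:1\le i\le n\}$. Then $\overrightarrow{G}\oplus_{wt_h}^s\overrightarrow{H}$ has vertex set $V(\overrightarrow{G})\cup V(\overrightarrow{H})$ and arc set $E(\overrightarrow{G})\cup E(\overrightarrow{H})\cup\bigcup_{i=1}^n(E^i\cup E^{ -i})$, where $E^i=\{(v_i,u): u\in V_h^{ -i-s}(\overrightarrow{H})\}$ and $E^{ -i}=\{(u,v_i): u\in V_h^{i+s}(\overrightarrow{H})\}$. -}

module Defs where

open import Data.Bool using (Bool; true; false; if_then_else_)
open import Data.Nat using (ℕ; zero; suc; _+_; _<_; _≤_; _⊔_)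
open import Data.Fin using (Fin; splitAt)
open import Data.List using (List; map; foldr)
open import Data.Nat.ListAction using (sum)
open import Data.List.Base using (allFin)
open import Data.Integer as ℤ using (ℤ; +_; -_; ∣_∣)
open import Data.Product using (Σ; _×_)
open import Data.Sum using (_⊎_; inj₁; inj₂)
open import Relation.Nullary.Decidable using (⌊_⌋)
open import Relation.Binary.PropositionalEquality using (_≡_)
open import Function.Definitions using (Injective)

-- A digraph on vertex set Fin N: Arc u v = true iff (u,v) is an arc.
-- (Bool-valued, so there are no multiple arcs.)
Digraph : ℕ → Set
Digraph N = Fin N → Fin N → Bool

-- Oriented graph: (u,v) an arc implies (v,u) is not an arc.
-- (With u = v this also excludes loops.)
IsOriented : ∀ {N} → Digraph N → Set
IsOriented {N} A = ∀ (u v : Fin N) → A u v ≡ true → A v u ≡ false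

Labeling : ℕ → Set
Labeling N = Fin N → ℕ

sumOver : ∀ {N} → (Fin N → Bool) → (Fin N → ℕ) → ℕ
sumOver {N} P f = sum (map (λ u → if P u then f u else 0) (allFin N))

-- wt_f(v) = Σ_{u ∈ N⁺(v)} f(u) − Σ_{u ∈ N⁻(v)} f(u),
-- where N⁺(v) = {u : (u,v) arc}, N⁻(v) = {u : (v,u) arc}.
wt : ∀ {N} → Digraph N → Labeling N → Fin N → ℤ
wt A f v = (+ sumOver (λ u → A u v) f) ℤ.- (+ sumOver (λ u → A v u) f)

IsBijOnto : ∀ {N} → ℕ → Labeling N → Set
IsBijOnto {N} lo f =
  Injective _≡_ _≡_ f
  × (∀ v → (lo < f v) × (f v ≤ lo + N))
  × (∀ k → lo < k → k ≤ lo + N → Σ (Fin N) (λ v → f v ≡ k))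

IsDDMLabeling : ∀ {N} → Digraph N → Labeling N → Set
IsDDMLabeling {N} A f = IsBijOnto 0 f × (∀ v → wt A f v ≡ + 0)

IsDDMOG : ∀ {N} → Digraph N → Set
IsDDMOG {N} A = IsOriented A × Σ (Labeling N) (λ f → IsDDMLabeling A f)

maxAbsWt : ∀ {M} → Digraph M → Labeling M → ℕ
maxAbsWt {M} H h = foldr _⊔_ 0 (map (λ v → ∣ wt H h v ∣) (allFin M))

sumLevel : ∀ {M} → Digraph M → Labeling M → ℤ → ℕ
sumLevel H h j = sumOver (λ v → ⌊ wt H h v ℤ.≟ j ⌋) h

-- The G-vertex x plays the role of v_i with i = g x.
-- E^i  = {(v_i,u) : wt_h(u) = -(i+s)},  E^{-i} = {(u,v_i) : wt_h(u) = i+s}.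
weightedSum : ∀ {n m} → Digraph n → Labeling n → ℕ →
              Digraph m → Labeling m → Digraph (n + m)
weightedSum {n} {m} G g s H h x y with splitAt n x | splitAt n y
... | inj₁ a | inj₁ b = G a b
... | inj₂ a | inj₂ b = H a b
... | inj₁ a | inj₂ u = ⌊ wt H h u ℤ.≟ - (+ (g a + s)) ⌋
... | inj₂ u | inj₁ a = ⌊ wt H h u ℤ.≟ + (g a + s) ⌋

-- Label G ⊕ H by g on G and by h on H; the labels then form {1, …, n + m}. A vertex v_i of G
-- keeps its arcs in G and gains the level V_h^i as in-neighbours and V_h^{-i} as out-neighbours,
-- whose label sums agree by hypothesis (for i beyond max |wt_h| both levels are empty). A vertex
-- u of H with wt_h(u) = w ≠ 0 gains exactly one neighbour, v_{|w|} (it exists as |w| ≤ n): an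
-- out-neighbour if w > 0 and an in-neighbour if w < 0, so its weight drops to w - w = 0.
module Submission where

open import Defs
open import Data.Bool using (Bool; true; false; if_then_else_)
open import Data.Bool.Properties using (T-≡)
open import Data.Nat using (ℕ; zero; suc; _+_; _≤_; _<_; _⊔_; z≤n; s≤s)
import Data.Nat.Properties as ℕ
open import Data.Fin using (Fin; splitAt; join; _↑ˡ_; _↑ʳ_)
import Data.Fin as F using (zero; suc)
open import Data.Fin.Properties using (suc-injective; splitAt-↑ˡ; splitAt-↑ʳ; join-splitAt)
open import Data.List using (List; _∷_; map; foldr; tabulate; allFin)
open import Data.List.Properties using (map-tabulate; map-cong)
open import Data.List.Membership.Propositional using (_∈_)
open import Data.List.Membership.Propositional.Properties using (∈-allFin; ∈-map⁺)
open import Data.List.Relation.Unary.Any using (here; there)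
open import Data.Nat.ListAction using (sum)
open import Data.Integer as ℤ using (ℤ; +_; -_; -[1+_]; ∣_∣)
import Data.Integer.Properties as ℤ
open import Data.Integer.Tactic.RingSolver using (solve-∀)
open import Data.Product using (Σ; _×_; _,_; proj₁; proj₂)
open import Data.Sum using (inj₁; inj₂; [_,_]′)
open import Function using (_∘_; Equivalence)
open import Function.Definitions using (Injective)
open import Relation.Nullary using (¬_; Dec; yes; no; contradiction)
open import Relation.Nullary.Decidable using (⌊_⌋; isYes≗does; dec-true; dec-false; toWitness)
open import Relation.Binary.PropositionalEquality
  using (_≡_; _≢_; refl; sym; trans; cong; cong₂; subst; module ≡-Reasoning)

isYes-true : ∀ {p} {P : Set p} (P? : Dec P) → P → ⌊ P? ⌋ ≡ true
isYes-true P? p = trans (isYes≗does P?) (dec-true P? p)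

isYes-false : ∀ {p} {P : Set p} (P? : Dec P) → ¬ P → ⌊ P? ⌋ ≡ false
isYes-false P? ¬p = trans (isYes≗does P?) (dec-false P? ¬p)

isYes-sound : ∀ {p} {P : Set p} (P? : Dec P) → ⌊ P? ⌋ ≡ true → P
isYes-sound P? e = toWitness {a? = P?} (Equivalence.from T-≡ e)

sumOver-suc : ∀ {N} (P : Fin (suc N) → Bool) (f : Fin (suc N) → ℕ) →
              sumOver P f ≡ (if P F.zero then f F.zero else 0) + sumOver (P ∘ F.suc) (f ∘ F.suc)
sumOver-suc {N} P f = cong sum (trans (map-tabulate (λ u → u) term)
                                  (cong (term F.zero ∷_) (sym (map-tabulate (λ u → u) (term ∘ F.suc)))))
  where
  term : Fin (suc N) → ℕ
  term u = if P u then f u else 0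

sumOver-cong : ∀ {N} {P Q : Fin N → Bool} {f f′ : Fin N → ℕ} →
               (∀ u → P u ≡ Q u) → (∀ u → f u ≡ f′ u) → sumOver P f ≡ sumOver Q f′
sumOver-cong {N} P≗Q f≗f′ =
  cong sum (map-cong (λ u → cong₂ (λ b x → if b then x else 0) (P≗Q u) (f≗f′ u)) (allFin N))

sumOver-empty : ∀ {N} (P : Fin N → Bool) (f : Fin N → ℕ) → (∀ u → P u ≡ false) → sumOver P f ≡ 0
sumOver-empty {zero}  P f P≡false = refl
sumOver-empty {suc N} P f P≡false
  rewrite sumOver-suc P f | P≡false F.zero = sumOver-empty (P ∘ F.suc) (f ∘ F.suc) (P≡false ∘ F.suc)

true-only-at : ∀ {N} {P : Fin N → Bool} {a b : Fin N} →
               (∀ c → P c ≡ true → c ≡ a) → b ≢ a → P b ≡ false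
true-only-at {P = P} {b = b} only-a b≢a with P b in Pb
... | false = refl
... | true  = contradiction (only-a b Pb) b≢a

sumOver-unique : ∀ {N} (P : Fin N → Bool) (f : Fin N → ℕ) {a : Fin N} →
                 P a ≡ true → (∀ b → P b ≡ true → b ≡ a) → sumOver P f ≡ f a
sumOver-unique P f {F.zero} Pa only-a rewrite sumOver-suc P f | Pa =
  trans (cong (λ rest → f F.zero + rest)
              (sumOver-empty (P ∘ F.suc) (f ∘ F.suc) (λ b → true-only-at only-a λ ())))
        (ℕ.+-identityʳ _)
sumOver-unique P f {F.suc a} Pa only-a rewrite sumOver-suc P f | true-only-at {b = F.zero} only-a (λ ()) =
  sumOver-unique (P ∘ F.suc) (f ∘ F.suc) Pa (λ b Psb → suc-injective (only-a (F.suc b) Psb))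

sumOver-↑ : ∀ {n m} (P : Fin (n + m) → Bool) (f : Fin (n + m) → ℕ) →
            sumOver P f ≡ sumOver (P ∘ (_↑ˡ m)) (f ∘ (_↑ˡ m)) + sumOver (P ∘ (n ↑ʳ_)) (f ∘ (n ↑ʳ_))
sumOver-↑ {zero}  P f = refl
sumOver-↑ {suc n} {m} P f = begin
  sumOver P f
    ≡⟨ sumOver-suc P f ⟩
  head + sumOver (P ∘ F.suc) (f ∘ F.suc)
    ≡⟨ cong (λ rest → head + rest) (sumOver-↑ {n} {m} (P ∘ F.suc) (f ∘ F.suc)) ⟩
  head + (sumOver (P ∘ F.suc ∘ (_↑ˡ m)) (f ∘ F.suc ∘ (_↑ˡ m)) + right)
    ≡⟨ ℕ.+-assoc head _ right ⟨
  (head + sumOver (P ∘ F.suc ∘ (_↑ˡ m)) (f ∘ F.suc ∘ (_↑ˡ m))) + right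
    ≡⟨ cong (_+ right) (sumOver-suc (P ∘ (_↑ˡ m)) (f ∘ (_↑ˡ m))) ⟨
  sumOver (P ∘ (_↑ˡ m)) (f ∘ (_↑ˡ m)) + right
    ∎
  where
  open ≡-Reasoning
  head right : ℕ
  head = if P F.zero then f F.zero else 0
  right = sumOver (P ∘ (suc n ↑ʳ_)) (f ∘ (suc n ↑ʳ_))

↑-elim : ∀ {n m} {P : Fin (n + m) → Set} →
         (∀ a → P (a ↑ˡ m)) → (∀ u → P (n ↑ʳ u)) → ∀ x → P x
↑-elim {n} {m} {P} left right x = subst P (join-splitAt n m x) (onSplit (splitAt n x))
  where
  onSplit : ∀ p → P (join n m p)
  onSplit (inj₁ a) = left a
  onSplit (inj₂ u) = right u

infixr 5 _++ₗ_

_++ₗ_ : ∀ {n m} → Labeling n → Labeling m → Labeling (n + m)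
_++ₗ_ {n} g h x = [ g , h ]′ (splitAt n x)

++ₗ-↑ˡ : ∀ {n m} (g : Labeling n) (h : Labeling m) a → (g ++ₗ h) (a ↑ˡ m) ≡ g a
++ₗ-↑ˡ {n} {m} g h a rewrite splitAt-↑ˡ n a m = refl

++ₗ-↑ʳ : ∀ {n m} (g : Labeling n) (h : Labeling m) u → (g ++ₗ h) (n ↑ʳ u) ≡ h u
++ₗ-↑ʳ {n} {m} g h u rewrite splitAt-↑ʳ n m u = refl

sumOver-++ₗ : ∀ {n m} {g : Labeling n} {h : Labeling m}
              {P : Fin (n + m) → Bool} {Pₗ : Fin n → Bool} {Pᵣ : Fin m → Bool} →
              (∀ a → P (a ↑ˡ m) ≡ Pₗ a) → (∀ u → P (n ↑ʳ u) ≡ Pᵣ u) →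
              sumOver P (g ++ₗ h) ≡ sumOver Pₗ g + sumOver Pᵣ h
sumOver-++ₗ {n} {m} {g} {h} {P} Pₗ≗ Pᵣ≗ =
  trans (sumOver-↑ {n} {m} P (g ++ₗ h))
        (cong₂ _+_ (sumOver-cong Pₗ≗ (++ₗ-↑ˡ g h)) (sumOver-cong Pᵣ≗ (++ₗ-↑ʳ g h)))

++ₗ-bijOnto : ∀ {n m lo} {g : Labeling n} {h : Labeling m} →
              IsBijOnto lo g → IsBijOnto (lo + n) h → IsBijOnto lo (g ++ₗ h)
++ₗ-bijOnto {n} {m} {lo} {g} {h} (g-inj , g-range , g-onto) (h-inj , h-range , h-onto) =
  injective , ↑-elim left-range right-range , onto
  where
  g<h : ∀ a u → g a < h u
  g<h a u = ℕ.≤-<-trans (proj₂ (g-range a)) (proj₁ (h-range u))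

  injective : Injective _≡_ _≡_ (g ++ₗ h)
  injective {x} {y} e = begin
    x                           ≡⟨ join-splitAt n m x ⟨
    join n m (splitAt n x)      ≡⟨ cong (join n m) (injective⊎ (splitAt n x) (splitAt n y) e) ⟩
    join n m (splitAt n y)      ≡⟨ join-splitAt n m y ⟩
    y                           ∎
    where
    open ≡-Reasoning
    injective⊎ : ∀ p q → [ g , h ]′ p ≡ [ g , h ]′ q → p ≡ q
    injective⊎ (inj₁ a) (inj₁ b) e = cong inj₁ (g-inj e)
    injective⊎ (inj₁ a) (inj₂ u) e = contradiction e (ℕ.<⇒≢ (g<h a u))
    injective⊎ (inj₂ u) (inj₁ a) e = contradiction (sym e) (ℕ.<⇒≢ (g<h a u))
    injective⊎ (inj₂ u) (inj₂ v) e = cong inj₂ (h-inj e)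

  left-range : ∀ a → (lo < (g ++ₗ h) (a ↑ˡ m)) × ((g ++ₗ h) (a ↑ˡ m) ≤ lo + (n + m))
  left-range a rewrite ++ₗ-↑ˡ g h a =
    proj₁ (g-range a) , ℕ.≤-trans (proj₂ (g-range a)) (ℕ.+-monoʳ-≤ lo (ℕ.m≤m+n n m))

  right-range : ∀ u → (lo < (g ++ₗ h) (n ↑ʳ u)) × ((g ++ₗ h) (n ↑ʳ u) ≤ lo + (n + m))
  right-range u rewrite ++ₗ-↑ʳ g h u =
    ℕ.≤-<-trans (ℕ.m≤m+n lo n) (proj₁ (h-range u)) ,
    subst (h u ≤_) (ℕ.+-assoc lo n m) (proj₂ (h-range u))

  onto : ∀ k → lo < k → k ≤ lo + (n + m) → Σ (Fin (n + m)) (λ x → (g ++ₗ h) x ≡ k)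
  onto k lo<k k≤ with k ℕ.≤? lo + n
  ... | yes k≤lo+n = let (a , ga≡k) = g-onto k lo<k k≤lo+n in a ↑ˡ m , trans (++ₗ-↑ˡ g h a) ga≡k
  ... | no  k≰lo+n = let (u , hu≡k) = h-onto k (ℕ.≰⇒> k≰lo+n) (subst (k ≤_) (sym (ℕ.+-assoc lo n m)) k≤)
                     in n ↑ʳ u , trans (++ₗ-↑ʳ g h u) hu≡k

+-minus-interchange : ∀ a b c d → + (a + b) ℤ.- + (c + d) ≡ (+ a ℤ.- + c) ℤ.+ (+ b ℤ.- + d)
+-minus-interchange a b c d rewrite ℤ.pos-+ a b | ℤ.pos-+ c d = interchange (+ a) (+ b) (+ c) (+ d)
  where
  interchange : ∀ (i j k l : ℤ) → (i ℤ.+ j) ℤ.- (k ℤ.+ l) ≡ (i ℤ.- k) ℤ.+ (j ℤ.- l)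
  interchange = solve-∀

+≢-+ : ∀ {k} → 0 < k → + k ≢ - (+ k)
+≢-+ {suc k} _ ()

module WeightedSum {n m} (G : Digraph n) (g : Labeling n) (s : ℕ) (H : Digraph m) (h : Labeling m) where

  A : Digraph (n + m)
  A = weightedSum G g s H h

  A-↑ˡ↑ˡ : ∀ a b → A (a ↑ˡ m) (b ↑ˡ m) ≡ G a b
  A-↑ˡ↑ˡ a b rewrite splitAt-↑ˡ n a m | splitAt-↑ˡ n b m = refl

  A-↑ʳ↑ʳ : ∀ u v → A (n ↑ʳ u) (n ↑ʳ v) ≡ H u v
  A-↑ʳ↑ʳ u v rewrite splitAt-↑ʳ n m u | splitAt-↑ʳ n m v = refl

  A-↑ˡ↑ʳ : ∀ a u → A (a ↑ˡ m) (n ↑ʳ u) ≡ ⌊ wt H h u ℤ.≟ - (+ (g a + s)) ⌋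
  A-↑ˡ↑ʳ a u rewrite splitAt-↑ˡ n a m | splitAt-↑ʳ n m u = refl

  A-↑ʳ↑ˡ : ∀ u a → A (n ↑ʳ u) (a ↑ˡ m) ≡ ⌊ wt H h u ℤ.≟ + (g a + s) ⌋
  A-↑ʳ↑ˡ u a rewrite splitAt-↑ˡ n a m | splitAt-↑ʳ n m u = refl

  -- An arc and its reverse between v_i and u would force wt_h(u) = i + s = -(i + s).
  oriented : IsOriented G → IsOriented H → (∀ a → 0 < g a) → IsOriented A
  oriented G-oriented H-oriented g-pos x y e with splitAt n x | splitAt n y
  ... | inj₁ a | inj₁ b = G-oriented a b e
  ... | inj₂ u | inj₂ v = H-oriented u v e
  ... | inj₁ a | inj₂ u =
    isYes-false _ λ w≡ → +≢-+ (ℕ.<-≤-trans (g-pos a) (ℕ.m≤m+n _ s)) (trans (sym w≡) (isYes-sound _ e))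
  ... | inj₂ u | inj₁ a =
    isYes-false _ λ w≡ → +≢-+ (ℕ.<-≤-trans (g-pos a) (ℕ.m≤m+n _ s)) (trans (sym (isYes-sound _ e)) w≡)

  wt-↑ˡ : ∀ a → wt A (g ++ₗ h) (a ↑ˡ m) ≡
                wt G g a ℤ.+ (+ sumLevel H h (+ (g a + s)) ℤ.- + sumLevel H h (- (+ (g a + s))))
  wt-↑ˡ a =
    trans (cong₂ (λ i o → + i ℤ.- + o) (sumOver-++ₗ (λ b → A-↑ˡ↑ˡ b a) (λ u → A-↑ʳ↑ˡ u a))
                                       (sumOver-++ₗ (A-↑ˡ↑ˡ a) (A-↑ˡ↑ʳ a)))
          (+-minus-interchange (sumOver (λ b → G b a) g) (sumLevel H h (+ (g a + s)))
                               (sumOver (G a) g) (sumLevel H h (- (+ (g a + s)))))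

  wt-↑ʳ : ∀ u → wt A (g ++ₗ h) (n ↑ʳ u) ≡
                (+ sumOver (λ a → ⌊ wt H h u ℤ.≟ - (+ (g a + s)) ⌋) g
                  ℤ.- + sumOver (λ a → ⌊ wt H h u ℤ.≟ + (g a + s) ⌋) g) ℤ.+ wt H h u
  wt-↑ʳ u =
    trans (cong₂ (λ i o → + i ℤ.- + o) (sumOver-++ₗ (λ a → A-↑ˡ↑ʳ a u) (λ v → A-↑ʳ↑ʳ v u))
                                       (sumOver-++ₗ (A-↑ʳ↑ˡ u) (A-↑ʳ↑ʳ u)))
          (+-minus-interchange (sumOver (λ a → ⌊ wt H h u ℤ.≟ - (+ (g a + s)) ⌋) g) (sumOver (λ v → H v u) h)
                               (sumOver (λ a → ⌊ wt H h u ℤ.≟ + (g a + s) ⌋) g) (sumOver (H u) h))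

  wt-↑ˡ≡0 : (∀ a → wt G g a ≡ + 0) → (∀ i → sumLevel H h (+ i) ≡ sumLevel H h (- (+ i))) →
            ∀ a → wt A (g ++ₗ h) (a ↑ˡ m) ≡ + 0
  wt-↑ˡ≡0 g-wt balanced a =
    trans (wt-↑ˡ a) (cong₂ ℤ._+_ (g-wt a) (ℤ.i≡j⇒i-j≡0 (cong +_ (balanced (g a + s)))))

∈⇒≤foldr-⊔ : ∀ {x} {xs : List ℕ} → x ∈ xs → x ≤ foldr _⊔_ 0 xs
∈⇒≤foldr-⊔ {xs = y ∷ ys} (here refl) = ℕ.m≤m⊔n y (foldr _⊔_ 0 ys)
∈⇒≤foldr-⊔ {xs = y ∷ ys} (there x∈ys) = ℕ.≤-trans (∈⇒≤foldr-⊔ x∈ys) (ℕ.m≤n⊔m y (foldr _⊔_ 0 ys))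

∣wt∣≤maxAbsWt : ∀ {m} (H : Digraph m) (h : Labeling m) u → ∣ wt H h u ∣ ≤ maxAbsWt H h
∣wt∣≤maxAbsWt H h u = ∈⇒≤foldr-⊔ (∈-map⁺ (λ v → ∣ wt H h v ∣) (∈-allFin u))

sumLevel-beyond-max : ∀ {m} (H : Digraph m) (h : Labeling m) {j} →
                      maxAbsWt H h < ∣ j ∣ → sumLevel H h j ≡ 0
sumLevel-beyond-max H h max<∣j∣ = sumOver-empty _ h λ u →
  isYes-false _ λ wt≡j → ℕ.<⇒≱ max<∣j∣ (subst (_≤ maxAbsWt H h) (cong ∣_∣ wt≡j) (∣wt∣≤maxAbsWt H h u))

sumLevel-balanced : ∀ {m} (H : Digraph m) (h : Labeling m) →
                    (∀ i → i ≤ maxAbsWt H h → sumLevel H h (+ i) ≡ sumLevel H h (- (+ i))) →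
                    ∀ i → sumLevel H h (+ i) ≡ sumLevel H h (- (+ i))
sumLevel-balanced H h balanced i with i ℕ.≤? maxAbsWt H h
... | yes i≤max = balanced i i≤max
... | no  i≰max = trans (sumLevel-beyond-max H h max<i)
                        (sym (sumLevel-beyond-max H h (subst (maxAbsWt H h <_) (sym (ℤ.∣-i∣≡∣i∣ (+ i))) max<i)))
  where
  max<i : maxAbsWt H h < i
  max<i = ℕ.≰⇒> i≰max

bijOnto-above : ∀ {n lo} {g : Labeling n} → IsBijOnto lo g → ∀ a → lo < g a
bijOnto-above (_ , g-range , _) a = proj₁ (g-range a)

sumOver-fibre : ∀ {n lo k} {g : Labeling n} (P : Fin n → Bool) → IsBijOnto lo g →
                lo < k → k ≤ lo + n → (∀ a → P a ≡ true → g a ≡ k) → (∀ a → g a ≡ k → P a ≡ true) →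
                sumOver P g ≡ k
sumOver-fibre {n} {k = k} {g = g} P (g-inj , _ , g-onto) lo<k k≤ sound complete =
  trans (sumOver-unique P g (complete a ga≡k) (λ b Pb → g-inj (trans (sound b Pb) (sym ga≡k)))) ga≡k
  where
  a : Fin n
  a = proj₁ (g-onto k lo<k k≤)
  ga≡k : g a ≡ k
  ga≡k = proj₂ (g-onto k lo<k k≤)

fibreBalance : ∀ {n} {g : Labeling n} → IsBijOnto 0 g → ∀ w → ∣ w ∣ ≤ n →
               + sumOver (λ a → ⌊ w ℤ.≟ - (+ g a) ⌋) g ℤ.- + sumOver (λ a → ⌊ w ℤ.≟ + g a ⌋) g ≡ - w
fibreBalance {g = g} g-bij (+ zero) _ =
  cong₂ (λ i o → + i ℤ.- + o)
        (sumOver-empty _ g λ a → isYes-false _ (+0≢-+ (g-pos a)))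
        (sumOver-empty _ g λ a → isYes-false _ λ e → ℕ.<⇒≢ (g-pos a) (ℤ.+-injective e))
  where
  g-pos : ∀ a → 0 < g a
  g-pos = bijOnto-above g-bij
  +0≢-+ : ∀ {x} → 0 < x → + 0 ≢ - (+ x)
  +0≢-+ {suc x} _ ()
fibreBalance {g = g} g-bij (+ suc k) ∣w∣≤n =
  cong₂ (λ i o → + i ℤ.- + o)
        (sumOver-empty _ g λ a → isYes-false _ +suc≢-+)
        (sumOver-fibre _ g-bij (s≤s z≤n) ∣w∣≤n (λ a Pa → sym (ℤ.+-injective (isYes-sound _ Pa)))
                                             (λ a e → isYes-true _ (cong +_ (sym e))))
  where
  +suc≢-+ : ∀ {x} → + suc k ≢ - (+ x)
  +suc≢-+ {zero}  ()
  +suc≢-+ {suc x} ()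
fibreBalance {g = g} g-bij -[1+ k ] ∣w∣≤n =
  trans (cong₂ (λ i o → + i ℤ.- + o)
               (sumOver-fibre _ g-bij (s≤s z≤n) ∣w∣≤n
                              (λ a Pa → sym (ℤ.+-injective (ℤ.neg-injective (isYes-sound _ Pa))))
                              (λ a e → isYes-true _ (cong (λ x → - (+ x)) (sym e))))
               (sumOver-empty _ g λ a → isYes-false (-[1+ k ] ℤ.≟ + g a) λ ()))
        (ℤ.+-identityʳ (+ suc k))

wt-↑ʳ≡0 : ∀ {n m} (G : Digraph n) (g : Labeling n) (H : Digraph m) (h : Labeling m) →
          IsBijOnto 0 g → (∀ u → ∣ wt H h u ∣ ≤ n) →
          ∀ u → wt (weightedSum G g 0 H h) (g ++ₗ h) (n ↑ʳ u) ≡ + 0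
wt-↑ʳ≡0 G g H h g-bij ∣wt∣≤n u =
  trans (WeightedSum.wt-↑ʳ G g 0 H h u)
        (trans (cong (ℤ._+ wt H h u) (trans unshift (fibreBalance g-bij (wt H h u) (∣wt∣≤n u))))
               (ℤ.+-inverseˡ (wt H h u)))
  where
  drop-+0 : ∀ (P : ℕ → Bool) → sumOver (λ a → P (g a + 0)) g ≡ sumOver (λ a → P (g a)) g
  drop-+0 P = sumOver-cong (λ a → cong P (ℕ.+-identityʳ (g a))) (λ _ → refl)
  unshift : + sumOver (λ a → ⌊ wt H h u ℤ.≟ - (+ (g a + 0)) ⌋) g
              ℤ.- + sumOver (λ a → ⌊ wt H h u ℤ.≟ + (g a + 0) ⌋) g
            ≡ + sumOver (λ a → ⌊ wt H h u ℤ.≟ - (+ g a) ⌋) g ℤ.- + sumOver (λ a → ⌊ wt H h u ℤ.≟ + g a ⌋) g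
  unshift = cong₂ (λ i o → + i ℤ.- + o) (drop-+0 λ x → ⌊ wt H h u ℤ.≟ - (+ x) ⌋)
                                        (drop-+0 λ x → ⌊ wt H h u ℤ.≟ + x ⌋)

theorem6 : (n m : ℕ) (G : Digraph n) (g : Labeling n) (H : Digraph m) (h : Labeling m) →
           IsOriented G → IsDDMLabeling G g →
           IsOriented H → IsBijOnto n h →
           maxAbsWt H h ≤ n →
           (∀ (i : ℕ) → i ≤ maxAbsWt H h → sumLevel H h (+ i) ≡ sumLevel H h (- (+ i))) →
           IsDDMOG (weightedSum G g 0 H h)
theorem6 n m G g H h G-oriented (g-bij , g-wt) H-oriented h-bij max≤n balanced =
  oriented G-oriented H-oriented (bijOnto-above g-bij) ,
  g ++ₗ h ,
  ++ₗ-bijOnto g-bij h-bij ,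
  ↑-elim (wt-↑ˡ≡0 g-wt (sumLevel-balanced H h balanced))
         (wt-↑ʳ≡0 G g H h g-bij (λ u → ℕ.≤-trans (∣wt∣≤maxAbsWt H h u) max≤n))
  where
  open WeightedSum G g 0 H h
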